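{- Let $n,t$ be positive integers with $t\le n-2$, and let $l$ be a positive integer satisfying the $\langle n,t\rangle$-condition. Then (1) $l>n$; (2) $C_{l-1}^{n-1}>n!\,C_{l-1}^{n-t-1}$; (3) $C_{l-2}^{n-2}>n!\,C_{l-2}^{n-t-2}$.
   Context: For positive integers $n,t$ with $t\le n-2$, a positive integer $l$ satisfies the $\langle n,t\rangle$-condition if: when $t=1$, $l>(n!+1)(n-1)$; when $t\ge2$, $l>2t$ and $C_{l-2}^{n-2}>n!\,C_{l-1}^{n-t-1}$. Here $C_m^k=\frac{m!}{k!(m-k)!}$ for integers $m\ge k\ge0$ and $C_m^k=0$ otherwise. -}

module Defs where

open import Data.Nat using (ℕ; zero; suc; _+_; _*_; _∸_; _<_; _!)
open import Data.Nat.Combinatorics using (_C_)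
open import Data.Product using (_×_)
open import Data.Empty using (⊥)

-- The ⟨n,t⟩-condition on l (defined only for positive t; t = 0 gives ⊥, never used
-- since the statement assumes 1 ≤ t).  Stdlib's  m C k  is 0 when k > m, matching
-- the paper.  Subtractions are truncated; under the standing hypotheses none of the
-- ones that matter truncate (n ≥ 3, t ≤ n-2, l ≥ 5).
NTCondition : ℕ → ℕ → ℕ → Set
NTCondition n zero l = ⊥
NTCondition n (suc zero) l = (n ! + 1) * (n ∸ 1) < l
NTCondition n (suc (suc k)) l =
  (2 * suc (suc k) < l) × (n ! * ((l ∸ 1) C (n ∸ suc (suc k) ∸ 1)) < (l ∸ 2) C (n ∸ 2))

{-# OPTIONS --safe #-}
module Submission where

-- For t = 1 everything follows from the ratio C(m,k+1)/C(m,k) = (m-k)/(k+1)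
-- (absorption identity), which exceeds n! once m ≥ (n!+1)(k+1).  For t ≥ 2,
-- Pascal's rule gives C(l-2,n-2) ≤ C(l-1,n-1) and C(l-2,n-t-2) ≤ C(l-1,n-t-1),
-- so both inequalities follow from the hypothesis; and l > n because
-- C(l-2,n-2) > n! C(l-1,n-t-1) ≥ 1, whereas C(m,k) ≤ 1 for k ≥ m.

open import Defs
open import Data.Nat using (ℕ; zero; suc; _+_; _*_; _∸_; _<_; _≤_; _!; z≤n; s≤s)
open import Data.Nat.Properties
open import Data.Nat.Combinatorics
  using (_C_; nC1≡n; nCn≡1; k>n⇒nCk≡0; nCk+nC[k+1]≡[n+1]C[k+1])
open import Data.Nat.Tactic.RingSolver using (solve-∀)
open import Data.Product using (_×_; _,_)
open import Data.Sum using (inj₁; inj₂)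
open import Relation.Nullary using (contradiction)
open import Relation.Binary.PropositionalEquality

nCk≤[n+1]C[k+1] : ∀ n k → n C k ≤ suc n C suc k
nCk≤[n+1]C[k+1] n k = subst (n C k ≤_) (nCk+nC[k+1]≡[n+1]C[k+1] n k) (m≤m+n _ _)

nC[k∸2]≤[n+1]C[k∸1] : ∀ n k → n C (k ∸ 2) ≤ suc n C (k ∸ 1)
nC[k∸2]≤[n+1]C[k∸1] n zero          = ≤-refl
nC[k∸2]≤[n+1]C[k∸1] n (suc zero)    = ≤-refl
nC[k∸2]≤[n+1]C[k∸1] n (suc (suc k)) = nCk≤[n+1]C[k+1] n k

k≤n⇒nCk>0 : ∀ {n k} → k ≤ n → 0 < n C k
k≤n⇒nCk>0 {k = zero}      _         = s≤s z≤n
k≤n⇒nCk>0 {suc n} {suc k} (s≤s k≤n) = <-≤-trans (k≤n⇒nCk>0 k≤n) (nCk≤[n+1]C[k+1] n k)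

nCk>0⇒k≤n : ∀ {n k} → 0 < n C k → k ≤ n
nCk>0⇒k≤n 0<nCk = ≮⇒≥ (λ n<k → <⇒≢ 0<nCk (sym (k>n⇒nCk≡0 n<k)))

nCk>1⇒k<n : ∀ {n k} → 1 < n C k → k < n
nCk>1⇒k<n {n} 1<nCk with m≤n⇒m<n∨m≡n (nCk>0⇒k≤n (<⇒≤ 1<nCk))
... | inj₁ k<n = k<n
... | inj₂ refl = contradiction (sym (nCn≡1 n)) (<⇒≢ 1<nCk)

c*n′Cj<nCk⇒k<n : ∀ {c n n′ j k} → 1 ≤ c → j ≤ k → n ≤ n′ → c * (n′ C j) < n C k → k < n
c*n′Cj<nCk⇒k<n {c} {n} {n′} {j} c≥1 j≤k n≤n′ lt = nCk>1⇒k<n (≤-<-trans c*n′Cj≥1 lt)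
  where
  c*n′Cj≥1 : 1 ≤ c * (n′ C j)
  c*n′Cj≥1 = *-mono-≤ c≥1 (k≤n⇒nCk>0 (≤-trans j≤k (≤-trans (nCk>0⇒k≤n (≤-<-trans z≤n lt)) n≤n′)))

-- Absorption, (k+1) C(n,k+1) = (n-k) C(n,k), with the subtraction moved across.
[k+1]*nC[k+1]+k*nCk≡n*nCk : ∀ n k → suc k * (n C suc k) + k * (n C k) ≡ n * (n C k)
[k+1]*nC[k+1]+k*nCk≡n*nCk n zero = begin
  1 * (n C 1) + 0  ≡⟨ +-identityʳ (1 * (n C 1)) ⟩
  1 * (n C 1)      ≡⟨ *-identityˡ (n C 1) ⟩
  n C 1            ≡⟨ nC1≡n n ⟩
  n                ≡⟨ *-identityʳ n ⟨
  n * 1            ∎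
  where open ≡-Reasoning
[k+1]*nC[k+1]+k*nCk≡n*nCk zero (suc k) = cong₂ _+_ (*-zeroʳ (2 + k)) (*-zeroʳ (1 + k))
[k+1]*nC[k+1]+k*nCk≡n*nCk (suc n) (suc k) = begin
  (2 + k) * (suc n C (2 + k)) + (1 + k) * (suc n C suc k)
    ≡⟨ cong₂ (λ u v → (2 + k) * u + (1 + k) * v) (pascal (suc k)) (pascal k) ⟨
  (2 + k) * (b + c) + (1 + k) * (a + b)
    ≡⟨ regroup k a b c ⟩
  ((2 + k) * c + (1 + k) * b) + ((1 + k) * b + k * a) + a + b
    ≡⟨ cong₂ (λ u v → u + v + a + b) (absorption (suc k)) (absorption k) ⟩
  n * b + n * a + a + b
    ≡⟨ collect n a b ⟩
  suc n * (a + b)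
    ≡⟨ cong (suc n *_) (pascal k) ⟩
  suc n * (suc n C suc k) ∎
  where
  open ≡-Reasoning
  pascal : ∀ j → n C j + n C suc j ≡ suc n C suc j
  pascal = nCk+nC[k+1]≡[n+1]C[k+1] n
  absorption : ∀ j → suc j * (n C suc j) + j * (n C j) ≡ n * (n C j)
  absorption = [k+1]*nC[k+1]+k*nCk≡n*nCk n
  a b c : ℕ
  a = n C k
  b = n C suc k
  c = n C (2 + k)
  regroup : ∀ k a b c → (2 + k) * (b + c) + (1 + k) * (a + b)
                        ≡ ((2 + k) * c + (1 + k) * b) + ((1 + k) * b + k * a) + a + b
  regroup = solve-∀
  collect : ∀ n a b → n * b + n * a + a + b ≡ suc n * (a + b)
  collect = solve-∀

[c+1][k+1]≤n⇒c*nCk<nC[k+1] : ∀ {c n k} → suc c * suc k ≤ n → c * (n C k) < n C suc k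
[c+1][k+1]≤n⇒c*nCk<nC[k+1] {c} {n} {k} bound = *-cancelˡ-< (suc k) (c * X) Y (begin-strict
  suc k * (c * X)      <⟨ m<m+n _ X>0 ⟩
  suc k * (c * X) + X  ≤⟨ +-cancelʳ-≤ (k * X) _ _ absorbed ⟩
  suc k * Y            ∎)
  where
  open ≤-Reasoning
  X Y : ℕ
  X = n C k
  Y = n C suc k
  X>0 : 0 < X
  X>0 = k≤n⇒nCk>0 (<⇒≤ (≤-trans (m≤n*m (suc k) (suc c)) bound))
  expand : ∀ c k X → suc k * (c * X) + X + k * X ≡ suc c * suc k * X
  expand = solve-∀
  absorbed : suc k * (c * X) + X + k * X ≤ suc k * Y + k * X
  absorbed = begin
    suc k * (c * X) + X + k * X  ≡⟨ expand c k X ⟩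
    suc c * suc k * X            ≤⟨ *-monoˡ-≤ X bound ⟩
    n * X                        ≡⟨ [k+1]*nC[k+1]+k*nCk≡n*nCk n k ⟨
    suc k * Y + k * X            ∎

ratio-bounds : ∀ {c p} l → 1 ≤ c → suc c * (2 + p) < l →
  (3 + p < l) × (c * ((l ∸ 1) C (1 + p)) < (l ∸ 1) C (2 + p))
    × (c * ((l ∸ 2) C p) < (l ∸ 2) C (1 + p))
ratio-bounds {c} {p} l c≥1 bound
  with ≤-<-trans (m<m+n (2 + p) (*-mono-≤ c≥1 (s≤s z≤n))) bound
... | 3+p<l@(s≤s (s≤s {n = m} _)) =
  3+p<l ,
  [c+1][k+1]≤n⇒c*nCk<nC[k+1] {c} {k = 1 + p} bound-l∸1 ,
  [c+1][k+1]≤n⇒c*nCk<nC[k+1] {c} {k = p} bound-l∸2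
  where
  bound-l∸1 : suc c * (2 + p) ≤ suc m
  bound-l∸1 = ≤-pred bound
  bound-l∸2 : suc c * (1 + p) ≤ m
  bound-l∸2 = m+n≤o⇒n≤o c (≤-pred (subst (_≤ suc m) (*-suc (suc c) (1 + p)) bound-l∸1))

pascal-bounds : ∀ {c k x} l → 1 ≤ c → x ≤ suc k → c * ((l ∸ 1) C (x ∸ 1)) < (l ∸ 2) C k →
  (2 + k < l) × (c * ((l ∸ 1) C (x ∸ 1)) < (l ∸ 1) C suc k)
    × (c * ((l ∸ 2) C (x ∸ 2)) < (l ∸ 2) C k)
pascal-bounds l c≥1 x≤1+k cond
  with c*n′Cj<nCk⇒k<n c≥1 (∸-monoˡ-≤ 1 x≤1+k) (∸-monoʳ-≤ l (n≤1+n 1)) cond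
pascal-bounds zero       _ _ _ | ()
pascal-bounds (suc zero) _ _ _ | ()
pascal-bounds {c} {k} {x} (suc (suc m)) _ _ cond | k<m =
  s≤s (s≤s k<m) ,
  <-≤-trans cond (nCk≤[n+1]C[k+1] m k) ,
  ≤-<-trans (*-monoʳ-≤ c (nC[k∸2]≤[n+1]C[k∸1] m x)) cond

lemma13 : (n t l : ℕ) → 1 ≤ t → t ≤ n ∸ 2 → 1 ≤ l → NTCondition n t l →
    (n < l) × (n ! * ((l ∸ 1) C (n ∸ t ∸ 1)) < (l ∸ 1) C (n ∸ 1))
    × (n ! * ((l ∸ 2) C (n ∸ t ∸ 2)) < (l ∸ 2) C (n ∸ 2))
lemma13 _                     zero          _ ()  _ _ _
lemma13 zero                  (suc _)       _ _   () _ _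
lemma13 (suc zero)            (suc _)       _ _   () _ _
lemma13 (suc (suc zero))      (suc _)       _ _   () _ _
lemma13 n@(suc (suc (suc p))) (suc zero)    l _ _ _ cond =
  ratio-bounds l (1≤n! n) (subst (λ d → d * (2 + p) < l) (+-comm (n !) 1) cond)
lemma13 n@(suc (suc k))       (suc (suc s)) l _ _ _ (_ , cond) =
  pascal-bounds l (1≤n! n) (≤-trans (m∸n≤m k s) (n≤1+n k)) cond
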